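{- Let $G=(V,E)$ be a graph with $V=\{1,\dots,n\}$ and $E=\{e_1,\dots,e_m\}$, and let $S(G)$ be as defined in the context. Then for every triple of distinct propositional variables $a,b,c$ occurring in $S(G)$: if every assignment satisfying all members of $S(G)$ also satisfies $a\oplus b\oplus c$, then $a\oplus b\oplus c\in S(G)$.
   Context: Use propositional variables $x_i$ and $z_i,z'_i$ for each vertex $i\in V$, and $y_k$ for each edge $e_k\in E$. Define $S(G)=S_1(G)\cup S_2(G)\cup S_3(G)$, a set of XOR-constraints, where $S_1(G)=\{x_i\oplus x_j\oplus y_k : e_k=\{i,j\}\}$, $S_2(G)=\{x_i\oplus z_i\oplus z'_i : i\in V\}$, and $S_3(G)=\{y_i\oplus y_j\oplus y_k : e_i,e_j,e_k \text{ form a triangle in } G\}$. Here $a\oplus b\oplus c$ denotes the Boolean function that is true iff an odd number of $a,b,c$ are true, and membership in $S(G)$ is understood as equality of functions (so e.g. $a\oplus b\oplus c=c\oplus a\oplus b$). $S(G)$ is satisfied by an assignment if all its members are. -}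

module Defs where

open import Data.Nat using (ℕ)
open import Data.Fin using (Fin)
open import Data.Bool using (Bool; _xor_; true)
open import Data.Product using (_×_; _,_; proj₁; proj₂; ∃-syntax)
open import Data.Sum using (_⊎_)
open import Relation.Binary.PropositionalEquality using (_≡_; _≢_)

-- A finite simple graph with vertex set Fin n and edge list e_0 … e_{m-1}
-- (0-indexed version of V = {1..n}, E = {e_1..e_m}).
-- Each edge is given by an ordered pair of endpoints; it denotes the
-- unordered 2-element set {u , v}.
EdgeIs : {n m : ℕ} → (Fin m → Fin n × Fin n) → Fin m → Fin n → Fin n → Set
EdgeIs ends k u v = (ends k ≡ (u , v)) ⊎ (ends k ≡ (v , u))

record Graph (n m : ℕ) : Set where
  field
    ends     : Fin m → Fin n × Fin n
    loopless : ∀ k → proj₁ (ends k) ≢ proj₂ (ends k)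
    distinct : ∀ k l u v → EdgeIs ends k u v → EdgeIs ends l u v → k ≡ l

open Graph public

data Var (n m : ℕ) : Set where
  x  : Fin n → Var n m
  z  : Fin n → Var n m
  z' : Fin n → Var n m
  y  : Fin m → Var n m

Assignment : ℕ → ℕ → Set
Assignment n m = Var n m → Bool

xor3 : {n m : ℕ} → Assignment n m → Var n m → Var n m → Var n m → Bool
xor3 σ a b c = (σ a xor σ b) xor σ c

Triangle : {n m : ℕ} → Graph n m → Fin m → Fin m → Fin m → Set
Triangle G i j k = ∃[ u ] ∃[ v ] ∃[ w ]
  (u ≢ v × v ≢ w × u ≢ w ×
   EdgeIs (ends G) i u v × EdgeIs (ends G) j v w × EdgeIs (ends G) k u w)

data Gen {n m : ℕ} (G : Graph n m) : Var n m → Var n m → Var n m → Set where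
  s1 : ∀ k i j → ends G k ≡ (i , j) → Gen G (x i) (x j) (y k)
  s2 : ∀ i → Gen G (x i) (z i) (z' i)
  s3 : ∀ i j k → Triangle G i j k → Gen G (y i) (y j) (y k)

-- a ⊕ b ⊕ c ∈ S(G), membership understood as equality of Boolean functions
InS : {n m : ℕ} → Graph n m → Var n m → Var n m → Var n m → Set
InS G a b c = ∃[ p ] ∃[ q ] ∃[ r ]
  (Gen G p q r × (∀ (σ : Assignment _ _) → xor3 σ a b c ≡ xor3 σ p q r))

Satisfies : {n m : ℕ} → Graph n m → Assignment n m → Set
Satisfies G σ = ∀ p q r → Gen G p q r → xor3 σ p q r ≡ true

Occurs : {n m : ℕ} → Graph n m → Var n m → Set
Occurs G v = ∃[ p ] ∃[ q ] ∃[ r ] (Gen G p q r × (v ≡ p ⊎ v ≡ q ⊎ v ≡ r))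

-- Fix the x- and z-variables arbitrarily and put z'ᵢ := ¬(xᵢ ⊕ zᵢ) and
-- y_k := ¬(x_u ⊕ x_v) for e_k = {u, v}: this is a model of S(G).  At the two
-- models with constant x and z, a ⊕ b ⊕ c can only hold if its variables are,
-- up to order, of kinds x x y, x z z', z z y, z' z' y or y y y.  The models in
-- which a single x- or z-variable is true then finish each case: x_u ⊕ x_v ⊕ y_k
-- forces e_k = {u, v}, x_i ⊕ z_j ⊕ z'_k forces i = j = k, the kinds z z y and
-- z' z' y are impossible, and y_i ⊕ y_j ⊕ y_k forces every vertex to lie on an
-- even number of e_i, e_j, e_k, which for e_i ≠ e_j, e_k makes them a triangle.
module Submission where

open import Defs
open import Data.Nat using (ℕ)
open import Data.Bool using (Bool; true; false; not; _xor_)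
open import Data.Bool.Properties
  using (xor-comm; xor-assoc; xor-inverseʳ; xor-annihilates-not; not-distribʳ-xor;
         not-involutive; not-injective; ¬-not)
open import Data.Fin using (Fin; _≟_)
open import Data.Empty using (⊥; ⊥-elim)
open import Data.Product using (_×_; _,_; proj₁; proj₂; ∃-syntax)
open import Data.Sum using (_⊎_; inj₁; inj₂; swap)
open import Function using (_∘_; const)
open import Relation.Nullary using (¬_; yes; no; does)
open import Relation.Nullary.Decidable using (dec-true; dec-false)
open import Relation.Binary.PropositionalEquality
  using (_≡_; _≢_; refl; sym; trans; cong; cong₂; subst; module ≡-Reasoning)

private variable
  n m : ℕ

xor-swap₁₂ : ∀ a b c → (a xor b) xor c ≡ (b xor a) xor c
xor-swap₁₂ a b c = cong (_xor c) (xor-comm a b)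

xor-swap₂₃ : ∀ a b c → (a xor b) xor c ≡ (a xor c) xor b
xor-swap₂₃ a b c = begin
  (a xor b) xor c  ≡⟨ xor-assoc a b c ⟩
  a xor (b xor c)  ≡⟨ cong (a xor_) (xor-comm b c) ⟩
  a xor (c xor b)  ≡⟨ xor-assoc a c b ⟨
  (a xor c) xor b  ∎
  where open ≡-Reasoning

xor≡false⇒ : ∀ {a b c} → (a xor b) xor c ≡ false → c ≡ a xor b
xor≡false⇒ {false} {false} {false} _ = refl
xor≡false⇒ {false} {true}  {true}  _ = refl
xor≡false⇒ {true}  {false} {true}  _ = refl
xor≡false⇒ {true}  {true}  {false} _ = refl
xor≡false⇒ {false} {false} {true}  ()
xor≡false⇒ {false} {true}  {false} ()
xor≡false⇒ {true}  {false} {false} ()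
xor≡false⇒ {true}  {true}  {true}  ()

nots-xor : ∀ a b c → (not a xor not b) xor not c ≡ not ((a xor b) xor c)
nots-xor a b c = trans (cong (_xor not c) (xor-annihilates-not a b))
                       (sym (not-distribʳ-xor (a xor b) c))

xor-triangle : ∀ a b c → ((a xor b) xor (b xor c)) xor (a xor c) ≡ false
xor-triangle false false false = refl
xor-triangle false false true  = refl
xor-triangle false true  false = refl
xor-triangle false true  true  = refl
xor-triangle true  false false = refl
xor-triangle true  false true  = refl
xor-triangle true  true  false = refl
xor-triangle true  true  true  = refl

data _↭₃_ {A : Set} : A × A × A → A × A × A → Set where
  id₃       : ∀ {a b c} → (a , b , c) ↭₃ (a , b , c)
  swap₁₂    : ∀ {a b c} → (a , b , c) ↭₃ (b , a , c)
  swap₂₃    : ∀ {a b c} → (a , b , c) ↭₃ (a , c , b)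
  swap₁₃    : ∀ {a b c} → (a , b , c) ↭₃ (c , b , a)
  rotate    : ∀ {a b c} → (a , b , c) ↭₃ (b , c , a)
  rotate⁻¹  : ∀ {a b c} → (a , b , c) ↭₃ (c , a , b)

xor3-↭ : ∀ {a b c p q r : Var n m} → (a , b , c) ↭₃ (p , q , r) →
         (τ : Assignment n m) → xor3 τ a b c ≡ xor3 τ p q r
xor3-↭                   id₃      τ = refl
xor3-↭ {a = a} {b} {c}   swap₁₂   τ = xor-swap₁₂ (τ a) (τ b) (τ c)
xor3-↭ {a = a} {b} {c}   swap₂₃   τ = xor-swap₂₃ (τ a) (τ b) (τ c)
xor3-↭ {a = a} {b} {c}   swap₁₃   τ =
  trans (xor-swap₁₂ (τ a) (τ b) (τ c))
        (trans (xor-swap₂₃ (τ b) (τ a) (τ c)) (xor-swap₁₂ (τ b) (τ c) (τ a)))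
xor3-↭ {a = a} {b} {c}   rotate   τ =
  trans (xor-swap₁₂ (τ a) (τ b) (τ c)) (xor-swap₂₃ (τ b) (τ a) (τ c))
xor3-↭ {a = a} {b} {c}   rotate⁻¹ τ =
  trans (xor-swap₂₃ (τ a) (τ b) (τ c)) (xor-swap₁₂ (τ a) (τ c) (τ b))

Entails : Graph n m → Var n m → Var n m → Var n m → Set
Entails G a b c = ∀ (σ : Assignment _ _) → Satisfies G σ → xor3 σ a b c ≡ true

InS-↭ : ∀ {G : Graph n m} {a b c p q r} → (a , b , c) ↭₃ (p , q , r) → InS G p q r → InS G a b c
InS-↭ π (s , t , u , gen , same) = s , t , u , gen , λ τ → trans (xor3-↭ π τ) (same τ)

Entails-↭ : ∀ {G : Graph n m} {a b c p q r} → (a , b , c) ↭₃ (p , q , r) → Entails G a b c → Entails G p q r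
Entails-↭ π H σ sat = trans (sym (xor3-↭ π σ)) (H σ sat)

data Shape {n m : ℕ} : Var n m → Var n m → Var n m → Set where
  x-x-y   : ∀ {i j k} → _≢_ {A = Var n m} (x i) (x j) → Shape (x i) (x j) (y k)
  x-z-z'  : ∀ {i j k} → Shape (x i) (z j) (z' k)
  z-z-y   : ∀ {i j k} → _≢_ {A = Var n m} (z i) (z j) → Shape (z i) (z j) (y k)
  z'-z'-y : ∀ {i j k} → _≢_ {A = Var n m} (z' i) (z' j) → Shape (z' i) (z' j) (y k)
  y-y-y   : ∀ {i j k} → _≢_ {A = Var n m} (y i) (y j) → _≢_ {A = Var n m} (y i) (y k) →
            Shape (y i) (y j) (y k)

data Arrangement {n m : ℕ} (a b c : Var n m) : Set where
  arranged : ∀ {p q r} → Shape p q r → (a , b , c) ↭₃ (p , q , r) → Arrangement a b c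

point : Fin n → Fin n → Bool
point w v = does (v ≟ w)

point-self : (w : Fin n) → point w w ≡ true
point-self w = dec-true (w ≟ w) refl

point-other : ∀ {v w : Fin n} → v ≢ w → point w v ≡ false
point-other {v = v} {w} = dec-false (v ≟ w)

module _ (G : Graph n m) where

  end₁ end₂ : Fin m → Fin n
  end₁ k = proj₁ (ends G k)
  end₂ k = proj₂ (ends G k)

  δ : (Fin n → Bool) → Fin m → Bool
  δ f k = f (end₁ k) xor f (end₂ k)

  δ-EdgeIs : ∀ f {k u v} → EdgeIs (ends G) k u v → δ f k ≡ f u xor f v
  δ-EdgeIs f (inj₁ e) = cong (λ uv → f (proj₁ uv) xor f (proj₂ uv)) e
  δ-EdgeIs f {u = u} {v} (inj₂ e) =
    trans (cong (λ vu → f (proj₁ vu) xor f (proj₂ vu)) e) (xor-comm (f v) (f u))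

  solution : (Fin n → Bool) → (Fin n → Bool) → Assignment n m
  solution f g (x i)  = f i
  solution f g (z i)  = g i
  solution f g (z' i) = not (f i xor g i)
  solution f g (y k)  = not (δ f k)

  solution-satisfies : ∀ f g → Satisfies G (solution f g)
  solution-satisfies f g _ _ _ (s1 k i j e) rewrite e = xor-inverseʳ (f i xor f j)
  solution-satisfies f g _ _ _ (s2 i) = xor-inverseʳ (f i xor g i)
  solution-satisfies f g _ _ _ (s3 i j k (u , v , w , _ , _ , _ , eᵢ , eⱼ , eₖ))
    rewrite δ-EdgeIs f eᵢ | δ-EdgeIs f eⱼ | δ-EdgeIs f eₖ
          | nots-xor (f u xor f v) (f v xor f w) (f u xor f w)
          | xor-triangle (f u) (f v) (f w) = refl

  entails-at : ∀ {a b c} → Entails G a b c → ∀ f g → xor3 (solution f g) a b c ≡ true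
  entails-at H f g = H (solution f g) (solution-satisfies f g)

  refute : ∀ {a b c} → Entails G a b c → ∀ f g → xor3 (solution f g) a b c ≡ false → ⊥
  refute H f g e with trans (sym (entails-at H f g)) e
  ... | ()

  Endpoint : Fin n → Fin m → Set
  Endpoint w k = w ≡ end₁ k ⊎ w ≡ end₂ k

  δ-point-sound : ∀ {w k} → δ (point w) k ≡ true → Endpoint w k
  δ-point-sound {w} {k} e with end₁ k ≟ w | end₂ k ≟ w
  ... | yes e₁ | _ = inj₁ (sym e₁)
  ... | no _ | yes e₂ = inj₂ (sym e₂)
  ... | no _ | no _ with e
  ... | ()

  δ-point-complete : ∀ {w k} → Endpoint w k → δ (point w) k ≡ true
  δ-point-complete {k = k} (inj₁ refl) =
    cong₂ _xor_ (point-self (end₁ k)) (point-other (loopless G k ∘ sym))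
  δ-point-complete {k = k} (inj₂ refl) =
    cong₂ _xor_ (point-other (loopless G k)) (point-self (end₂ k))

  edge-between : ∀ {k u v} → Endpoint u k → Endpoint v k → u ≢ v → EdgeIs (ends G) k u v
  edge-between (inj₁ refl) (inj₁ refl) u≢v = ⊥-elim (u≢v refl)
  edge-between (inj₁ refl) (inj₂ refl) _   = inj₁ refl
  edge-between (inj₂ refl) (inj₁ refl) _   = inj₂ refl
  edge-between (inj₂ refl) (inj₂ refl) u≢v = ⊥-elim (u≢v refl)

  other-endpoint : ∀ {k u} → Endpoint u k → ∃[ w ] (EdgeIs (ends G) k u w × u ≢ w)
  other-endpoint {k} (inj₁ refl) = end₂ k , inj₁ refl , loopless G k
  other-endpoint {k} (inj₂ refl) = end₁ k , inj₂ refl , loopless G k ∘ sym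

  EdgeIs-endpointʳ : ∀ {k u v} → EdgeIs (ends G) k u v → Endpoint v k
  EdgeIs-endpointʳ (inj₁ e) = inj₂ (sym (cong proj₂ e))
  EdgeIs-endpointʳ (inj₂ e) = inj₁ (sym (cong proj₁ e))

  InS-edge : ∀ {k u v} → EdgeIs (ends G) k u v → InS G (x u) (x v) (y k)
  InS-edge {k} {u} {v} (inj₁ e) = x u , x v , y k , s1 k u v e , λ _ → refl
  InS-edge {k} {u} {v} (inj₂ e) = x v , x u , y k , s1 k v u e , xor3-↭ swap₁₂

  entails-endpoint : ∀ {u v k} → u ≢ v → Entails G (x u) (x v) (y k) → Endpoint u k
  entails-endpoint {u} {v} {k} u≢v H = δ-point-sound (begin
    δ (point u) k
      ≡⟨ not-involutive _ ⟨
    not (not (δ (point u) k))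
      ≡⟨ cong₂ (λ s t → (s xor t) xor not (δ (point u) k)) (point-self u) (point-other (u≢v ∘ sym)) ⟨
    xor3 (solution (point u) (const false)) (x u) (x v) (y k)
      ≡⟨ entails-at H (point u) (const false) ⟩
    true ∎)
    where open ≡-Reasoning

  entails-S₁ : ∀ {u v k} → u ≢ v → Entails G (x u) (x v) (y k) → InS G (x u) (x v) (y k)
  entails-S₁ u≢v H = InS-edge (edge-between (entails-endpoint u≢v H)
                                            (entails-endpoint (u≢v ∘ sym) (Entails-↭ swap₁₂ H))
                                            u≢v)

  entails-S₂ : ∀ {i j k} → Entails G (x i) (z j) (z' k) → InS G (x i) (z j) (z' k)
  entails-S₂ {i} {j} {k} H with k ≟ j
  ... | no k≢j = ⊥-elim (refute H (const false) (point j)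
          (cong₂ (λ s t → s xor not t) (point-self j) (point-other k≢j)))
  ... | yes refl with j ≟ i
  ... | no j≢i = ⊥-elim (refute H (point i) (const false)
          (cong₂ (λ s t → (s xor false) xor not (t xor false)) (point-self i) (point-other j≢i)))
  ... | yes refl = x i , z i , z' i , s2 i , λ _ → refl

  ¬entails-z-z-y : ∀ {i j k} → i ≢ j → ¬ Entails G (z i) (z j) (y k)
  ¬entails-z-z-y {i} i≢j H = refute H (const false) (point i)
    (cong₂ (λ s t → (s xor t) xor true) (point-self i) (point-other (i≢j ∘ sym)))

  ¬entails-z'-z'-y : ∀ {i j k} → i ≢ j → ¬ Entails G (z' i) (z' j) (y k)
  ¬entails-z'-z'-y {i} i≢j H = refute H (const false) (point i)
    (cong₂ (λ s t → (not s xor not t) xor true) (point-self i) (point-other (i≢j ∘ sym)))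

  EvenlyCovered : Fin m → Fin m → Fin m → Set
  EvenlyCovered i j k = ∀ w → (δ (point w) i xor δ (point w) j) xor δ (point w) k ≡ false

  EvenlyCovered-swap : ∀ {i j k} → EvenlyCovered i j k → EvenlyCovered i k j
  EvenlyCovered-swap {i} {j} {k} even w =
    trans (sym (xor-swap₂₃ (δ (point w) i) (δ (point w) j) (δ (point w) k))) (even w)

  entails-evenlyCovered : ∀ {i j k} → Entails G (y i) (y j) (y k) → EvenlyCovered i j k
  entails-evenlyCovered {i} {j} {k} H w = not-injective {y = false}
    (trans (sym (nots-xor (δ (point w) i) (δ (point w) j) (δ (point w) k)))
           (entails-at H (point w) (const false)))

  endpoint-of-third : ∀ {i j k w} → EvenlyCovered i j k →
                      δ (point w) i xor δ (point w) j ≡ true → Endpoint w k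
  endpoint-of-third {i} {j} {w = w} even odd =
    δ-point-sound (trans (xor≡false⇒ {δ (point w) i} {δ (point w) j} (even w)) odd)

  Triangle-swap : ∀ {i j k} → Triangle G i j k → Triangle G i k j
  Triangle-swap (u , v , w , u≢v , v≢w , u≢w , eᵢ , eⱼ , eₖ) =
    v , u , w , u≢v ∘ sym , u≢w , v≢w , swap eᵢ , eₖ , eⱼ

  triangle-through : ∀ {i j k} → i ≢ j → EvenlyCovered i j k → Endpoint (end₁ i) j → Triangle G i j k
  -- With eᵢ = {u, v} and eⱼ = {u, w}, both v and w lie on exactly one of eᵢ, eⱼ,
  -- hence on eₖ.
  triangle-through {i} {j} {k} i≢j even uⱼ =
    v , u , w , loopless G i ∘ sym , u≢w , v≢w , swap eᵢ , eⱼ , edge-between vₖ wₖ v≢w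
    where
    u v : Fin n
    u = end₁ i
    v = end₂ i
    eᵢ : EdgeIs (ends G) i u v
    eᵢ = inj₁ refl
    w : Fin n
    w = proj₁ (other-endpoint uⱼ)
    eⱼ : EdgeIs (ends G) j u w
    eⱼ = proj₁ (proj₂ (other-endpoint uⱼ))
    u≢w : u ≢ w
    u≢w = proj₂ (proj₂ (other-endpoint uⱼ))
    eⱼ≢uv : ¬ EdgeIs (ends G) j u v
    eⱼ≢uv = i≢j ∘ distinct G i j u v eᵢ
    v≢w : v ≢ w
    v≢w v≡w = eⱼ≢uv (subst (EdgeIs (ends G) j u) (sym v≡w) eⱼ)
    v-off-j : δ (point v) j ≡ false
    v-off-j = ¬-not (λ vⱼ → eⱼ≢uv (edge-between uⱼ (δ-point-sound vⱼ) (loopless G i)))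
    w-off-i : δ (point w) i ≡ false
    w-off-i = ¬-not (w-off-eᵢ ∘ δ-point-sound)
      where
      w-off-eᵢ : ¬ Endpoint w i
      w-off-eᵢ (inj₁ w≡u) = u≢w (sym w≡u)
      w-off-eᵢ (inj₂ w≡v) = v≢w (sym w≡v)
    vₖ : Endpoint v k
    vₖ = endpoint-of-third even (cong₂ _xor_ (δ-point-complete (inj₂ refl)) v-off-j)
    wₖ : Endpoint w k
    wₖ = endpoint-of-third even (cong₂ _xor_ w-off-i (δ-point-complete (EdgeIs-endpointʳ eⱼ)))

  evenly-covered-triangle : ∀ {i j k} → i ≢ j → i ≢ k → EvenlyCovered i j k → Triangle G i j k
  evenly-covered-triangle {i} {j} {k} i≢j i≢k even with δ (point (end₁ i)) j in uⱼ
  ... | true  = triangle-through i≢j even (δ-point-sound uⱼ)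
  ... | false = Triangle-swap (triangle-through i≢k (EvenlyCovered-swap even) uₖ)
    where
    uₖ : Endpoint (end₁ i) k
    uₖ = endpoint-of-third even (cong₂ _xor_ (δ-point-complete (inj₁ refl)) uⱼ)

  entails-S₃ : ∀ {i j k} → i ≢ j → i ≢ k → Entails G (y i) (y j) (y k) → InS G (y i) (y j) (y k)
  entails-S₃ {i} {j} {k} i≢j i≢k H =
    y i , y j , y k , s3 i j k (evenly-covered-triangle i≢j i≢k (entails-evenlyCovered H)) , λ _ → refl

  shape-InS : ∀ {a b c} → Shape a b c → Entails G a b c → InS G a b c
  shape-InS (x-x-y ne)       = entails-S₁ (ne ∘ cong x)
  shape-InS x-z-z'           = entails-S₂
  shape-InS (z-z-y ne)       = ⊥-elim ∘ ¬entails-z-z-y (ne ∘ cong z)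
  shape-InS (z'-z'-y ne)     = ⊥-elim ∘ ¬entails-z'-z'-y (ne ∘ cong z')
  shape-InS (y-y-y ne₁ ne₂)  = entails-S₃ (ne₁ ∘ cong y) (ne₂ ∘ cong y)

  -- In the two models below a variable's value only depends on its kind:
  -- x, z, z', y take the values 0, 0, 1, 1 and 0, 1, 0, 1 respectively.
  KindParity : Var n m → Var n m → Var n m → Set
  KindParity a b c = xor3 (solution (const false) (const false)) a b c ≡ true
                   × xor3 (solution (const false) (const true)) a b c ≡ true

  entails-kindParity : ∀ {a b c} → Entails G a b c → KindParity a b c
  entails-kindParity H = entails-at H (const false) (const false) , entails-at H (const false) (const true)

  Arranges : Var n m → Set
  Arranges a = ∀ b c → a ≢ b → b ≢ c → a ≢ c → KindParity a b c → Arrangement a b c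

  arrange-x : ∀ i → Arranges (x i)
  arrange-x _ (x _) (x _) _ _ _ (() , _)
  arrange-x _ (x _) (z _) _ _ _ (() , _)
  arrange-x _ (x _) (z' _) _ _ _ (_ , ())
  arrange-x _ (x _) (y _) a≢b _ _ _ = arranged (x-x-y a≢b) id₃
  arrange-x _ (z _) (x _) _ _ _ (() , _)
  arrange-x _ (z _) (z _) _ _ _ (() , _)
  arrange-x _ (z _) (z' _) _ _ _ _ = arranged x-z-z' id₃
  arrange-x _ (z _) (y _) _ _ _ (_ , ())
  arrange-x _ (z' _) (x _) _ _ _ (_ , ())
  arrange-x _ (z' _) (z _) _ _ _ _ = arranged x-z-z' swap₂₃
  arrange-x _ (z' _) (z' _) _ _ _ (() , _)
  arrange-x _ (z' _) (y _) _ _ _ (() , _)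
  arrange-x _ (y _) (x _) _ _ a≢c _ = arranged (x-x-y a≢c) swap₂₃
  arrange-x _ (y _) (z _) _ _ _ (_ , ())
  arrange-x _ (y _) (z' _) _ _ _ (() , _)
  arrange-x _ (y _) (y _) _ _ _ (() , _)

  arrange-z : ∀ i → Arranges (z i)
  arrange-z _ (x _) (x _) _ _ _ (() , _)
  arrange-z _ (x _) (z _) _ _ _ (() , _)
  arrange-z _ (x _) (z' _) _ _ _ _ = arranged x-z-z' swap₁₂
  arrange-z _ (x _) (y _) _ _ _ (_ , ())
  arrange-z _ (z _) (x _) _ _ _ (() , _)
  arrange-z _ (z _) (z _) _ _ _ (() , _)
  arrange-z _ (z _) (z' _) _ _ _ (_ , ())
  arrange-z _ (z _) (y _) a≢b _ _ _ = arranged (z-z-y a≢b) id₃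
  arrange-z _ (z' _) (x _) _ _ _ _ = arranged x-z-z' rotate⁻¹
  arrange-z _ (z' _) (z _) _ _ _ (_ , ())
  arrange-z _ (z' _) (z' _) _ _ _ (() , _)
  arrange-z _ (z' _) (y _) _ _ _ (() , _)
  arrange-z _ (y _) (x _) _ _ _ (_ , ())
  arrange-z _ (y _) (z _) _ _ a≢c _ = arranged (z-z-y a≢c) swap₂₃
  arrange-z _ (y _) (z' _) _ _ _ (() , _)
  arrange-z _ (y _) (y _) _ _ _ (() , _)

  arrange-z' : ∀ i → Arranges (z' i)
  arrange-z' _ (x _) (x _) _ _ _ (_ , ())
  arrange-z' _ (x _) (z _) _ _ _ _ = arranged x-z-z' rotate
  arrange-z' _ (x _) (z' _) _ _ _ (() , _)
  arrange-z' _ (x _) (y _) _ _ _ (() , _)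
  arrange-z' _ (z _) (x _) _ _ _ _ = arranged x-z-z' swap₁₃
  arrange-z' _ (z _) (z _) _ _ _ (_ , ())
  arrange-z' _ (z _) (z' _) _ _ _ (() , _)
  arrange-z' _ (z _) (y _) _ _ _ (() , _)
  arrange-z' _ (z' _) (x _) _ _ _ (() , _)
  arrange-z' _ (z' _) (z _) _ _ _ (() , _)
  arrange-z' _ (z' _) (z' _) _ _ _ (_ , ())
  arrange-z' _ (z' _) (y _) a≢b _ _ _ = arranged (z'-z'-y a≢b) id₃
  arrange-z' _ (y _) (x _) _ _ _ (() , _)
  arrange-z' _ (y _) (z _) _ _ _ (() , _)
  arrange-z' _ (y _) (z' _) _ _ a≢c _ = arranged (z'-z'-y a≢c) swap₂₃
  arrange-z' _ (y _) (y _) _ _ _ (_ , ())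

  arrange-y : ∀ i → Arranges (y i)
  arrange-y _ (x _) (x _) _ b≢c _ _ = arranged (x-x-y b≢c) rotate
  arrange-y _ (x _) (z _) _ _ _ (_ , ())
  arrange-y _ (x _) (z' _) _ _ _ (() , _)
  arrange-y _ (x _) (y _) _ _ _ (() , _)
  arrange-y _ (z _) (x _) _ _ _ (_ , ())
  arrange-y _ (z _) (z _) _ b≢c _ _ = arranged (z-z-y b≢c) rotate
  arrange-y _ (z _) (z' _) _ _ _ (() , _)
  arrange-y _ (z _) (y _) _ _ _ (() , _)
  arrange-y _ (z' _) (x _) _ _ _ (() , _)
  arrange-y _ (z' _) (z _) _ _ _ (() , _)
  arrange-y _ (z' _) (z' _) _ b≢c _ _ = arranged (z'-z'-y b≢c) rotate
  arrange-y _ (z' _) (y _) _ _ _ (_ , ())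
  arrange-y _ (y _) (x _) _ _ _ (() , _)
  arrange-y _ (y _) (z _) _ _ _ (() , _)
  arrange-y _ (y _) (z' _) _ _ _ (_ , ())
  arrange-y _ (y _) (y _) a≢b _ a≢c _ = arranged (y-y-y a≢b a≢c) id₃

  arrange : ∀ a → Arranges a
  arrange (x i)  = arrange-x i
  arrange (z i)  = arrange-z i
  arrange (z' i) = arrange-z' i
  arrange (y i)  = arrange-y i

lemma24 : {n m : ℕ} (G : Graph n m) (a b c : Var n m) →
    Occurs G a → Occurs G b → Occurs G c →
    a ≢ b → b ≢ c → a ≢ c →
    (∀ (σ : Assignment n m) → Satisfies G σ → xor3 σ a b c ≡ true) →
    InS G a b c
-- Every variable occurs in S₁(G) ∪ S₂(G), so the occurrence hypotheses carry no information.
lemma24 G a b c _ _ _ a≢b b≢c a≢c H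
  with arranged shape π ← arrange G a b c a≢b b≢c a≢c (entails-kindParity G H)
  = InS-↭ π (shape-InS G shape (Entails-↭ π H))
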